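{- Let $\Lambda$ be a pseudo-symmetric numerical semigroup whose smallest nonzero element $\lambda_1$ satisfies $\lambda_1\neq 3$, and whose nonzero non-gaps smaller than the conductor form more than one maximal interval of consecutive integers. Then $\Lambda$ is a leave of the semigroup tree, i.e. $\Lambda$ has no generator greater than or equal to its conductor.
   Context: A numerical semigroup is a subset $\Lambda\subseteq\mathbb{N}_0$ containing $0$, closed under addition, with finite complement; gaps are elements of $\mathbb{N}_0\setminus\Lambda$, non-gaps are elements of $\Lambda$, genus $g$ = number of gaps, conductor $c$ = smallest integer such that all integers $\geq c$ lie in $\Lambda$. $\Lambda$ is pseudo-symmetric if $c=2g-1$. Generators are the elements of the minimal generating set. In the semigroup tree the children of $\Lambda$ are the semigroups $\Lambda\setminus\{x\}$ with $x$ a generator, $x\geq c$; a leave is a node with no children. -}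

module Defs where

open import Data.Nat using (ℕ; zero; suc; _+_; _*_; _∸_; _≤_; _<_)
open import Data.Bool using (Bool; true; false; not; _∧_; _∨_; if_then_else_)
open import Data.Product using (Σ; ∃; _×_; _,_)
open import Relation.Binary.PropositionalEquality using (_≡_; _≢_)
open import Relation.Nullary using (¬_)

record NumericalSemigroup : Set where
  field
    mem      : ℕ → Bool
    zero∈    : mem 0 ≡ true
    closed   : ∀ a b → mem a ≡ true → mem b ≡ true → mem (a + b) ≡ true
    cofinite : ∃ λ N → ∀ n → N ≤ n → mem n ≡ true
open NumericalSemigroup public

_∈S_ : ℕ → NumericalSemigroup → Set
x ∈S S = mem S x ≡ true

IsGap : NumericalSemigroup → ℕ → Set
IsGap S x = mem S x ≡ false

count : (ℕ → Bool) → ℕ → ℕ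
count p zero = 0
count p (suc n) = (if p n then 1 else 0) + count p n

IsConductor : NumericalSemigroup → ℕ → Set
IsConductor S c =
  (∀ n → c ≤ n → n ∈S S) × (∀ d → (∀ n → d ≤ n → n ∈S S) → c ≤ d)

-- the genus = number of gaps (all gaps lie below the conductor c)
genusWith : NumericalSemigroup → ℕ → ℕ
genusWith S c = count (λ x → not (mem S x)) c

-- pseudo-symmetric: c = 2g - 1 (over ℤ), i.e. c + 1 = 2g
IsPseudoSymmetric : NumericalSemigroup → Set
IsPseudoSymmetric S = ∀ c → IsConductor S c → c + 1 ≡ 2 * genusWith S c

IsMultiplicity : NumericalSemigroup → ℕ → Set
IsMultiplicity S m = 0 < m × m ∈S S × (∀ x → 0 < x → x ∈S S → m ≤ x)

nzNonGap : NumericalSemigroup → ℕ → Bool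
nzNonGap S zero = false
nzNonGap S (suc x) = mem S (suc x)

-- x is the left endpoint of a maximal interval of consecutive nonzero non-gaps
intervalStart : NumericalSemigroup → ℕ → Bool
intervalStart S zero = false
intervalStart S (suc x) = nzNonGap S (suc x) ∧ not (nzNonGap S x)

numIntervalsBelow : NumericalSemigroup → ℕ → ℕ
numIntervalsBelow S c = count (intervalStart S) c

-- generator: element of the minimal generating set, i.e. a nonzero element
-- that is not a sum of two nonzero elements
IsGenerator : NumericalSemigroup → ℕ → Set
IsGenerator S x =
  0 < x × x ∈S S ×
  ¬ (Σ ℕ λ a → Σ ℕ λ b → 0 < a × 0 < b × a ∈S S × b ∈S S × a + b ≡ x)

IsLeave : NumericalSemigroup → Set
IsLeave S = ∀ c → IsConductor S c → ∀ x → IsGenerator S x → x < c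

{-# OPTIONS --safe #-}
module Submission where

-- Let c = F + 1 and let m be the multiplicity. Pseudo-symmetry (c + 1 = 2g) forces F = 2h and
-- makes y = h the only y ≤ F with y and F − y both gaps; so every other gap y < F has
-- F − y ∈ S, hence y + m ≤ F. A second interval of non-gaps starts at some s > m whose
-- predecessor w ≥ m is a gap; were h < m, then w + m ≤ F = 2h < w + m, so m ≤ h and
-- h + m ≤ F as well. Now take x ≥ c and y = x − m: if y ∈ S then x = y + m; a gap y < F is
-- impossible since y + m ≤ F < x; and for y = F, among the at least m − 1 ≥ 3 values y' < c
-- with m + y' ∈ S and y' ∉ S one differs from F and h, giving x = (m + y') + (F − y').

open import Defs
open import Data.Bool using (Bool; true; false; not; _∧_; if_then_else_)
open import Data.Bool.Properties using (∧-conicalˡ; ∧-conicalʳ; ∧-identityʳ; ∧-zeroʳ; not-injective)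
open import Data.Empty using (⊥; ⊥-elim)
open import Data.Nat using (ℕ; zero; suc; _+_; _*_; _∸_; _≤_; _<_; z≤n; s≤s; _≟_; _≤?_; ⌊_/2⌋)
open import Data.Nat.Divisibility using (_∣_; divides; 1∣_)
open import Data.Nat.Properties
open import Data.Nat.Tactic.RingSolver using (solve-∀)
open import Data.Product using (Σ; ∃; _×_; _,_; proj₁; proj₂)
open import Data.Sum using (_⊎_; inj₁; inj₂)
open import Function using (_∘_; case_of_)
open import Relation.Nullary using (¬_; yes; no; contradiction)
open import Relation.Nullary.Decidable using (⌊_⌋)
open import Relation.Binary.PropositionalEquality
  using (_≡_; _≢_; refl; sym; trans; cong; cong₂; subst; module ≡-Reasoning)

count-cong : ∀ {p q : ℕ → Bool} n → (∀ y → y < n → p y ≡ q y) → count p n ≡ count q n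
count-cong zero eq = refl
count-cong (suc n) eq =
  cong₂ _+_ (cong (λ b → if b then 1 else 0) (eq n ≤-refl))
            (count-cong n (λ y y<n → eq y (m<n⇒m<1+n y<n)))

count-mono : ∀ {p q : ℕ → Bool} n → (∀ y → y < n → p y ≡ true → q y ≡ true) →
             count p n ≤ count q n
count-mono zero p⇒q = z≤n
count-mono {p} {q} (suc n) p⇒q with p n in pn | q n in qn
... | true  | true  = s≤s (count-mono n (λ y y<n → p⇒q y (m<n⇒m<1+n y<n)))
... | true  | false = case trans (sym (p⇒q n ≤-refl pn)) qn of λ ()
... | false | true  = m≤n⇒m≤1+n (count-mono n (λ y y<n → p⇒q y (m<n⇒m<1+n y<n)))
... | false | false = count-mono n (λ y y<n → p⇒q y (m<n⇒m<1+n y<n))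

count-complement : ∀ p n → count p n + count (not ∘ p) n ≡ n
count-complement p zero = refl
count-complement p (suc n) with p n
... | true  = cong suc (count-complement p n)
... | false = trans (+-suc (count p n) _) (cong suc (count-complement p n))

count-∧-split : ∀ (p q : ℕ → Bool) n →
                count p n ≡ count (λ y → p y ∧ q y) n + count (λ y → p y ∧ not (q y)) n
count-∧-split p q zero = refl
count-∧-split p q (suc n) with p n | q n
... | true  | true  = cong suc (count-∧-split p q n)
... | true  | false = trans (cong suc (count-∧-split p q n)) (sym (+-suc _ _))
... | false | _     = count-∧-split p q n

count-+ : ∀ p m n → count p (m + n) ≡ count (λ i → p (m + i)) n + count p m
count-+ p m zero = cong (count p) (+-identityʳ m)
count-+ p m (suc n) rewrite +-suc m n =
  trans (cong (top +_) (count-+ p m n)) (sym (+-assoc top _ (count p m)))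
  where
  top : ℕ
  top = if p (m + n) then 1 else 0

count-true : ∀ {p} n → (∀ i → i < n → p i ≡ true) → count p n ≡ n
count-true zero all = refl
count-true (suc n) all rewrite all n ≤-refl =
  cong suc (count-true n (λ i i<n → all i (m<n⇒m<1+n i<n)))

count-false : ∀ {p} n → (∀ i → i < n → p i ≡ false) → count p n ≡ 0
count-false zero none = refl
count-false (suc n) none rewrite none n ≤-refl =
  count-false n (λ i i<n → none i (m<n⇒m<1+n i<n))

count-reverse : ∀ p n → count (λ y → p (n ∸ y)) (suc n) ≡ count p (suc n)
count-reverse p zero = refl
count-reverse p (suc n) = begin
  count (λ y → p (suc n ∸ y)) (1 + suc n)         ≡⟨ count-+ (λ y → p (suc n ∸ y)) 1 (suc n) ⟩
  count (λ y → p (n ∸ y)) (suc n) + (top + 0)     ≡⟨ cong₂ _+_ (count-reverse p n) (+-identityʳ top) ⟩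
  count p (suc n) + top                           ≡⟨ +-comm (count p (suc n)) top ⟩
  count p (suc (suc n))                           ∎
  where
  open ≡-Reasoning
  top : ℕ
  top = if p (suc n) then 1 else 0

count>0⇒∃ : ∀ {p} n → 0 < count p n → ∃ λ y → y < n × p y ≡ true
count>0⇒∃ {p} (suc n) pos with p n in pn
... | true  = n , ≤-refl , pn
... | false with count>0⇒∃ n pos
...   | y , y<n , py = y , m<n⇒m<1+n y<n , py

∃⇒count>0 : ∀ {p y} n → y < n → p y ≡ true → 0 < count p n
∃⇒count>0 {p} {y} (suc n) y<1+n py with p n in pn | m<1+n⇒m<n∨m≡n y<1+n
... | true  | _          = s≤s z≤n
... | false | inj₁ y<n   = ∃⇒count>0 n y<n py
... | false | inj₂ refl  = case trans (sym py) pn of λ ()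

_except_ : (ℕ → Bool) → ℕ → ℕ → Bool
(p except a) y = p y ∧ not ⌊ y ≟ a ⌋

except-≢ : ∀ p {a y} → y ≢ a → (p except a) y ≡ p y
except-≢ p {a} {y} y≢a with y ≟ a
... | yes y≡a = contradiction y≡a y≢a
... | no _    = ∧-identityʳ (p y)

except-true : ∀ p {a y} → (p except a) y ≡ true → p y ≡ true × y ≢ a
except-true p {a} {y} h with y ≟ a
... | no y≢a = ∧-conicalˡ _ _ h , y≢a
... | yes _  = case trans (sym h) (∧-zeroʳ (p y)) of λ ()

count-except-≤ : ∀ p a n → count p n ≤ suc (count (p except a) n)
count-except-≤ p a zero = z≤n
count-except-≤ p a (suc n) with p n | n ≟ a
... | false | _     = count-except-≤ p a n
... | true  | no _  = s≤s (count-except-≤ p a n)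
... | true  | yes refl =
  s≤s (≤-reflexive (count-cong n (λ y y<n → sym (except-≢ p (<⇒≢ y<n)))))

except-self : ∀ p a → (p except a) a ≡ false
except-self p a with a ≟ a
... | yes _   = ∧-zeroʳ (p a)
... | no a≢a  = contradiction refl a≢a

count-except-< : ∀ p {a} n → a < n → p a ≡ true → count (p except a) n < count p n
count-except-< p {a} (suc n) a<1+n pa with m<1+n⇒m<n∨m≡n a<1+n
... | inj₂ refl rewrite except-self p a | pa =
  s≤s (count-mono n (λ y _ → ∧-conicalˡ _ _))
... | inj₁ a<n rewrite except-≢ p (>⇒≢ a<n) =
  +-monoʳ-< (if p n then 1 else 0) (count-except-< p n a<n pa)

2<count⇒∃-avoiding : ∀ {p} n a b → 2 < count p n → ∃ λ y → y < n × p y ≡ true × y ≢ a × y ≢ b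
2<count⇒∃-avoiding {p} n a b 2<count
  with count>0⇒∃ n (≤-pred (≤-pred (≤-trans 2<count
         (≤-trans (count-except-≤ p a n) (s≤s (count-except-≤ (p except a) b n))))))
... | y , y<n , y-avoiding with except-true (p except a) y-avoiding
...   | y-avoiding-a , y≢b with except-true p y-avoiding-a
...     | py , y≢a = y , y<n , py , y≢a , y≢b

search-least : ∀ (p : ℕ → Bool) b →
               (∀ k → k < b → p k ≡ false) ⊎ (∃ λ m → p m ≡ true × (∀ k → k < m → p k ≡ false))
search-least p zero = inj₁ (λ _ ())
search-least p (suc b) with search-least p b
... | inj₂ least = inj₂ least
... | inj₁ none with p b in pb
...   | true  = inj₂ (b , pb , none)
...   | false = inj₁ λ k k<1+b → case m<1+n⇒m<n∨m≡n k<1+b of λ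
                  { (inj₁ k<b) → none k k<b ; (inj₂ refl) → pb }

least-true : ∀ (p : ℕ → Bool) n → p n ≡ true → ∃ λ m → p m ≡ true × (∀ k → k < m → p k ≡ false)
least-true p n pn with search-least p (suc n)
... | inj₂ least = least
... | inj₁ none  = case trans (sym pn) (none n ≤-refl) of λ ()

≢1,2,3⇒3< : ∀ {n} → 0 < n → n ≢ 1 → n ≢ 2 → n ≢ 3 → 3 < n
≢1,2,3⇒3< {1} _ n≢1 _ _ = contradiction refl n≢1
≢1,2,3⇒3< {2} _ _ n≢2 _ = contradiction refl n≢2
≢1,2,3⇒3< {3} _ _ _ n≢3 = contradiction refl n≢3
≢1,2,3⇒3< {suc (suc (suc (suc n)))} _ _ _ _ = s≤s (s≤s (s≤s (s≤s z≤n)))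

Decomposable : NumericalSemigroup → ℕ → Set
Decomposable S x = Σ ℕ λ a → Σ ℕ λ b → 0 < a × 0 < b × a ∈S S × b ∈S S × a + b ≡ x

module _ (S : NumericalSemigroup) where

  ∈⇒¬gap : ∀ {x} → x ∈S S → ¬ IsGap S x
  ∈⇒¬gap x∈S x∉S = case trans (sym x∈S) x∉S of λ ()

  *-closed : ∀ {k} → k ∈S S → ∀ j → (j * k) ∈S S
  *-closed k∈S zero    = zero∈ S
  *-closed k∈S (suc j) = closed S _ _ k∈S (*-closed k∈S j)

  ∣-closed : ∀ {k n} → k ∈S S → k ∣ n → n ∈S S
  ∣-closed k∈S (divides q refl) = *-closed k∈S q

  gap<conductor : ∀ {c y} → IsConductor S c → IsGap S y → y < c
  gap<conductor (above , _) y∉S = ≰⇒> (λ c≤y → ∈⇒¬gap (above _ c≤y) y∉S)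

  frobenius-gap : ∀ {F} → IsConductor S (suc F) → IsGap S F
  frobenius-gap {F} (above , least) with mem S F in F∈S
  ... | false = refl
  ... | true  = ⊥-elim (1+n≰n (least F from-F))
    where
    from-F : ∀ n → F ≤ n → n ∈S S
    from-F n F≤n with F ≟ n
    ... | yes refl = F∈S
    ... | no F≢n   = above n (≤∧≢⇒< F≤n F≢n)

  nonzero-nzNonGap-gap : ∀ {w} → 0 < w → nzNonGap S w ≡ false → IsGap S w
  nonzero-nzNonGap-gap {suc w} _ w∉S = w∉S

  multiplicity-exists : ∃ (IsMultiplicity S)
  multiplicity-exists with cofinite S
  ... | N , from-N with least-true (nzNonGap S) (suc N) (from-N (suc N) (n≤1+n N))
  ...   | zero  , () , _
  ...   | suc m , m∈S , below = suc m , s≤s z≤n , m∈S , minimal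
    where
    minimal : ∀ x → 0 < x → x ∈S S → suc m ≤ x
    minimal (suc x) _ x∈S = ≮⇒≥ (λ x<m → ∈⇒¬gap x∈S (below (suc x) x<m))

+-double-injective : ∀ {m n} → m + m ≡ n + n → m ≡ n
+-double-injective {m} {n} e = trans (n≡⌊n+n/2⌋ m) (trans (cong ⌊_/2⌋ e) (sym (n≡⌊n+n/2⌋ n)))

suc-n+1≡2*m⇒n≡[m∸1]+[m∸1] : ∀ n m → suc n + 1 ≡ 2 * m → n ≡ (m ∸ 1) + (m ∸ 1)
suc-n+1≡2*m⇒n≡[m∸1]+[m∸1] n (suc m) e = +-cancelʳ-≡ 2 n (m + m) (begin
  n + 2          ≡⟨ +-suc n 1 ⟩
  suc n + 1      ≡⟨ e ⟩
  2 * suc m      ≡⟨ double-suc m ⟩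
  (m + m) + 2    ∎)
  where
  open ≡-Reasoning
  double-suc : ∀ m → 2 * suc m ≡ (m + m) + 2
  double-suc = solve-∀

module PseudoSymmetric (S : NumericalSemigroup) (F : ℕ)
  (conductor : IsConductor S (suc F))
  (pseudoSymmetric : suc F + 1 ≡ 2 * genusWith S (suc F)) where

  h : ℕ
  h = genusWith S (suc F) ∸ 1

  F≡h+h : F ≡ h + h
  F≡h+h = suc-n+1≡2*m⇒n≡[m∸1]+[m∸1] F (genusWith S (suc F)) pseudoSymmetric

  F∉S : IsGap S F
  F∉S = frobenius-gap S conductor

  ¬-both-∈ : ∀ {y} → y ≤ F → y ∈S S → (F ∸ y) ∈S S → ⊥
  ¬-both-∈ y≤F y∈S Fy∈S = ∈⇒¬gap S (subst (_∈S S) (m+[n∸m]≡n y≤F) (closed S _ _ y∈S Fy∈S)) F∉S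

  doubleGap : ℕ → Bool
  doubleGap y = not (mem S y) ∧ not (mem S (F ∸ y))

  -- The gaps y < c with F − y ∈ S correspond under y ↦ F − y to the A elements of S below c,
  -- so g = A + #doubleGap; together with A + g = c and c + 1 = 2g this leaves one doubleGap.
  count-doubleGap≡1 : count doubleGap (suc F) ≡ 1
  count-doubleGap≡1 = p≡1 {A} {P} (count-complement (mem S) (suc F)) genus≡A+P pseudoSymmetric
    where
    open ≡-Reasoning
    A P : ℕ
    A = count (mem S) (suc F)
    P = count doubleGap (suc F)

    gap-then-reflected-∈ : ∀ y → y < suc F → (not (mem S y) ∧ mem S (F ∸ y)) ≡ mem S (F ∸ y)
    gap-then-reflected-∈ y y<c with mem S y in y∈S | mem S (F ∸ y) in Fy∈S
    ... | true  | true  = ⊥-elim (¬-both-∈ (≤-pred y<c) y∈S Fy∈S)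
    ... | true  | false = refl
    ... | false | _     = refl

    genus≡A+P : genusWith S (suc F) ≡ A + P
    genus≡A+P = begin
      count (not ∘ mem S) (suc F)                                  ≡⟨ count-∧-split (not ∘ mem S) (λ y → mem S (F ∸ y)) (suc F) ⟩
      count (λ y → not (mem S y) ∧ mem S (F ∸ y)) (suc F) + P      ≡⟨ cong (_+ P) (count-cong (suc F) gap-then-reflected-∈) ⟩
      count (λ y → mem S (F ∸ y)) (suc F) + P                      ≡⟨ cong (_+ P) (count-reverse (mem S) F) ⟩
      A + P                                                        ∎

    p≡1 : ∀ {a p g c} → a + g ≡ c → g ≡ a + p → c + 1 ≡ 2 * g → p ≡ 1
    p≡1 {a} {p} {g} {c} a+g≡c g≡a+p c+1≡2g =
      sym (+-cancelˡ-≡ p 1 p (+-cancelˡ-≡ (a + a) (p + 1) (p + p) (begin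
        (a + a) + (p + 1)   ≡⟨ regroup₁ a p ⟩
        (a + (a + p)) + 1   ≡⟨ cong (λ g → a + g + 1) g≡a+p ⟨
        (a + g) + 1         ≡⟨ cong (_+ 1) a+g≡c ⟩
        c + 1               ≡⟨ c+1≡2g ⟩
        2 * g               ≡⟨ cong (2 *_) g≡a+p ⟩
        2 * (a + p)         ≡⟨ regroup₂ a p ⟩
        (a + a) + (p + p)   ∎)))
      where
      regroup₁ : ∀ a p → (a + a) + (p + 1) ≡ (a + (a + p)) + 1
      regroup₁ = solve-∀
      regroup₂ : ∀ a p → 2 * (a + p) ≡ (a + a) + (p + p)
      regroup₂ = solve-∀

  gap-reflect : ∀ {y} → y ≤ F → IsGap S y → y ≢ h → (F ∸ y) ∈S S
  gap-reflect {y} y≤F y∉S y≢h with mem S (F ∸ y) in Fy∉S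
  ... | true  = refl
  ... | false = ⊥-elim (<⇒≱ (∃⇒count>0 (suc F) (s≤s (m∸n≤m F y)) reflected-doubleGap) (≤-pred one-too-many))
    where
    open ≡-Reasoning
    F∸y≢y : F ∸ y ≢ y
    F∸y≢y F∸y≡y = y≢h (+-double-injective (begin
      y + y        ≡⟨ cong (y +_) F∸y≡y ⟨
      y + (F ∸ y)  ≡⟨ m+[n∸m]≡n y≤F ⟩
      F            ≡⟨ F≡h+h ⟩
      h + h        ∎))
    reflected-doubleGap : (doubleGap except y) (F ∸ y) ≡ true
    reflected-doubleGap = trans (except-≢ doubleGap F∸y≢y)
      (cong₂ (λ a b → not a ∧ not b) Fy∉S (trans (cong (mem S) (m∸[m∸n]≡n y≤F)) y∉S))
    one-too-many : count (doubleGap except y) (suc F) < 1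
    one-too-many = subst (count (doubleGap except y) (suc F) <_) count-doubleGap≡1
      (count-except-< doubleGap (suc F) (s≤s y≤F) (cong₂ (λ a b → not a ∧ not b) y∉S Fy∉S))

  module Multiplicity {m : ℕ} (multiplicity : IsMultiplicity S m) where

    0<m : 0 < m
    0<m = proj₁ multiplicity

    m∈S : m ∈S S
    m∈S = proj₁ (proj₂ multiplicity)

    m-least : ∀ x → 0 < x → x ∈S S → m ≤ x
    m-least = proj₂ (proj₂ multiplicity)

    m∤F : ¬ m ∣ F
    m∤F m∣F = ∈⇒¬gap S (∣-closed S m∈S m∣F) F∉S

    3<m : m ≢ 3 → 3 < m
    3<m m≢3 = ≢1,2,3⇒3< 0<m (λ m≡1 → m∤F (subst (_∣ F) (sym m≡1) (1∣ F)))
                          (λ m≡2 → m∤F (subst (_∣ F) (sym m≡2) 2∣F)) m≢3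
      where
      2∣F : 2 ∣ F
      2∣F = divides h (trans F≡h+h (trans (cong (h +_) (sym (+-identityʳ h))) (*-comm 2 h)))

    reflected-gap+m≤F : ∀ {y} → y < F → IsGap S y → y ≢ h → y + m ≤ F
    reflected-gap+m≤F {y} y<F y∉S y≢h =
      subst (y + m ≤_) (m+[n∸m]≡n (<⇒≤ y<F))
        (+-monoʳ-≤ y (m-least (F ∸ y) (m<n⇒0<n∸m y<F) (gap-reflect (<⇒≤ y<F) y∉S y≢h)))

    gap+m≤F : m ≤ h → ∀ {y} → y < F → IsGap S y → y + m ≤ F
    gap+m≤F m≤h {y} y<F y∉S with y ≟ h
    ... | no y≢h   = reflected-gap+m≤F y<F y∉S y≢h
    ... | yes refl = subst (y + m ≤_) (sym F≡h+h) (+-monoʳ-≤ y m≤h)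

    m≤h : 1 < numIntervalsBelow S (suc F) → m ≤ h
    m≤h twoIntervals with m ≤? h
    ... | yes m≤h = m≤h
    ... | no m≰h = ⊥-elim (second-interval (count>0⇒∃ (suc F) another-interval))
      where
      h<m : h < m
      h<m = ≰⇒> m≰h
      another-interval : 0 < count (intervalStart S except m) (suc F)
      another-interval = ≤-pred (≤-trans twoIntervals (count-except-≤ (intervalStart S) m (suc F)))
      second-interval : (∃ λ s → s < suc F × (intervalStart S except m) s ≡ true) → ⊥
      second-interval (zero , _ , ())
      second-interval (suc w , 1+w<c , start-except) =
        <⇒≱ (+-mono-< h<w h<m) (subst (w + m ≤_) F≡h+h (reflected-gap+m≤F w<F w∉S (>⇒≢ h<w)))
        where
        start : intervalStart S (suc w) ≡ true
        start = proj₁ (except-true (intervalStart S) start-except)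
        1+w≢m : suc w ≢ m
        1+w≢m = proj₂ (except-true (intervalStart S) start-except)
        m≤w : m ≤ w
        m≤w = ≤-pred (≤∧≢⇒< (m-least (suc w) (s≤s z≤n) (∧-conicalˡ _ _ start)) (1+w≢m ∘ sym))
        h<w : h < w
        h<w = <-≤-trans h<m m≤w
        w<F : w < F
        w<F = ≤-pred 1+w<c
        w∉S : IsGap S w
        w∉S = nonzero-nzNonGap-gap S (<-≤-trans 0<m m≤w) (not-injective (∧-conicalʳ _ _ start))

    count-below-m≡1 : count (mem S) m ≡ 1
    count-below-m≡1 = begin
      count (mem S) m                                           ≡⟨ cong (count (mem S)) (m+[n∸m]≡n 0<m) ⟨
      count (mem S) (1 + (m ∸ 1))                               ≡⟨ count-+ (mem S) 1 (m ∸ 1) ⟩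
      count (λ i → mem S (suc i)) (m ∸ 1) + count (mem S) 1     ≡⟨ cong₂ _+_ (count-false (m ∸ 1) nonzero-below-m)
                                                                            (cong (λ b → (if b then 1 else 0) + 0) (zero∈ S)) ⟩
      1                                                         ∎
      where
      open ≡-Reasoning
      nonzero-below-m : ∀ i → i < m ∸ 1 → mem S (suc i) ≡ false
      nonzero-below-m i i<m∸1 with mem S (suc i) in 1+i∈S
      ... | false = refl
      ... | true  = ⊥-elim (<⇒≱ 1+i<m (m-least (suc i) (s≤s z≤n) 1+i∈S))
        where
        1+i<m : suc i < m
        1+i<m = subst (suc i <_) (m+[n∸m]≡n 0<m) (s≤s i<m∸1)

    aperyShift : ℕ → Bool
    aperyShift y = mem S (m + y) ∧ not (mem S y)

    -- S ∩ [m, m + c) has m + A − 1 elements, counted from either end; at most A of them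
    -- are m + y with y ∈ S.
    m≤1+count-aperyShift : m ≤ suc (count aperyShift (suc F))
    m≤1+count-aperyShift = +-cancelʳ-≤ A m (suc Q) (begin
      m + A                                         ≡⟨ count-shifted ⟨
      count (λ y → mem S (m + y)) (suc F) + 1       ≡⟨ cong (_+ 1) (count-∧-split (λ y → mem S (m + y)) (mem S) (suc F)) ⟩
      (R + Q) + 1                                   ≤⟨ +-monoˡ-≤ 1 (+-monoˡ-≤ Q R≤A) ⟩
      (A + Q) + 1                                   ≡⟨ +-comm (A + Q) 1 ⟩
      suc (A + Q)                                   ≡⟨ cong suc (+-comm A Q) ⟩
      suc Q + A                                     ∎)
      where
      open ≤-Reasoning
      A Q R : ℕ
      A = count (mem S) (suc F)
      Q = count aperyShift (suc F)
      R = count (λ y → mem S (m + y) ∧ mem S y) (suc F)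
      R≤A : R ≤ A
      R≤A = count-mono (suc F) (λ y _ → ∧-conicalʳ _ _)
      count-shifted : count (λ y → mem S (m + y)) (suc F) + 1 ≡ m + A
      count-shifted = begin-equality
        count (λ y → mem S (m + y)) (suc F) + 1                 ≡⟨ cong (count (λ y → mem S (m + y)) (suc F) +_) count-below-m≡1 ⟨
        count (λ y → mem S (m + y)) (suc F) + count (mem S) m   ≡⟨ count-+ (mem S) m (suc F) ⟨
        count (mem S) (m + suc F)                               ≡⟨ cong (count (mem S)) (+-comm m (suc F)) ⟩
        count (mem S) (suc F + m)                               ≡⟨ count-+ (mem S) (suc F) m ⟩
        count (λ i → mem S (suc F + i)) m + A                   ≡⟨ cong (_+ A) (count-true m (λ i _ → proj₁ conductor (suc F + i) (m≤m+n (suc F) i))) ⟩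
        m + A                                                   ∎

    m+F-decomposable : 3 < m → Decomposable S (m + F)
    m+F-decomposable 3<m
      with 2<count⇒∃-avoiding (suc F) F h (≤-pred (≤-trans 3<m m≤1+count-aperyShift))
    ... | y , y<c , m+y∈S∧y∉S , y≢F , y≢h =
      m + y , F ∸ y , ≤-trans 0<m (m≤m+n m y) , m<n⇒0<n∸m y<F ,
      ∧-conicalˡ _ _ m+y∈S∧y∉S ,
      gap-reflect (<⇒≤ y<F) (not-injective (∧-conicalʳ _ _ m+y∈S∧y∉S)) y≢h ,
      trans (+-assoc m y (F ∸ y)) (cong (m +_) (m+[n∸m]≡n (<⇒≤ y<F)))
      where
      y<F : y < F
      y<F = ≤∧≢⇒< (≤-pred y<c) y≢F

    above-conductor-decomposable : 3 < m → m ≤ h → ∀ {x} → suc F ≤ x → Decomposable S x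
    above-conductor-decomposable 3<m m≤h {x} c≤x = decompose (x ∸ m) (m∸n+n≡m m≤x)
      where
      m≤F : m ≤ F
      m≤F = ≤-trans m≤h (subst (h ≤_) (sym F≡h+h) (m≤m+n h h))
      m≤x : m ≤ x
      m≤x = ≤-trans m≤F (≤-trans (n≤1+n F) c≤x)
      decompose : ∀ y → y + m ≡ x → Decomposable S x
      decompose y y+m≡x with mem S y in y∈?S
      decompose zero    y+m≡x | true = ⊥-elim (<⇒≱ (s≤s m≤F) (subst (suc F ≤_) (sym y+m≡x) c≤x))
      decompose (suc y) y+m≡x | true = suc y , m , s≤s z≤n , 0<m , y∈?S , m∈S , y+m≡x
      decompose y       y+m≡x | false with y ≟ F
      ... | yes refl = subst (Decomposable S) (trans (+-comm m F) y+m≡x) (m+F-decomposable 3<m)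
      ... | no y≢F   = ⊥-elim (<⇒≱ (subst (suc F ≤_) (sym y+m≡x) c≤x)
                                   (gap+m≤F m≤h (≤∧≢⇒< (≤-pred (gap<conductor S conductor y∈?S)) y≢F) y∈?S))

mainTheorem5 : (S : NumericalSemigroup) → IsPseudoSymmetric S →
    (∀ m → IsMultiplicity S m → m ≢ 3) →
    (∀ c → IsConductor S c → 1 < numIntervalsBelow S c) →
    IsLeave S
mainTheorem5 S pseudoSymmetric m≢3 twoIntervals zero conductor _ _ =
  case pseudoSymmetric zero conductor of λ ()
mainTheorem5 S pseudoSymmetric m≢3 twoIntervals (suc F) conductor x (_ , _ , indecomposable) =
  ≰⇒> (indecomposable ∘ above-conductor-decomposable (3<m (m≢3 m multiplicity))
                                                     (m≤h (twoIntervals (suc F) conductor)))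
  where
  open PseudoSymmetric S F conductor (pseudoSymmetric (suc F) conductor)
  m : ℕ
  m = proj₁ (multiplicity-exists S)
  multiplicity : IsMultiplicity S m
  multiplicity = proj₂ (multiplicity-exists S)
  open Multiplicity multiplicity
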